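{- Let $G$ be a finite connected graph with $n$ vertices. If $G$ admits two disjoint matchings whose union contains at least $n-1$ edges, then $\mu(G)=\lfloor n/2\rfloor=\nu(G)$.
   Context: All graphs are finite, simple, undirected and loopless. $\nu(G)$ is the maximum size of a matching in $G$. $\lambda(G)=\max\{|H|+|H'| : H,H' \text{ are disjoint matchings in } G\}$, $\Lambda(G)$ is the set of ordered pairs $(H,H')$ of disjoint matchings of $G$ with $|H|+|H'|=\lambda(G)$, and $\mu(G)=\max\{|H| : (H,H')\in\Lambda(G)\}$. -}

module Defs where

open import Data.Nat using (ℕ; _≤_; _+_)
open import Data.Fin using (Fin)
open import Data.Fin.Subset using (Subset; _∈_; _∉_; ∣_∣)
open import Data.Product using (Σ; _×_; _,_; proj₁; proj₂; ∃)
open import Data.Sum using (_⊎_)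
open import Relation.Binary.PropositionalEquality using (_≡_; _≢_)

record Graph (n : ℕ) : Set where
  field
    m     : ℕ
    edge  : Fin m → Fin n × Fin n
    loopless : ∀ e → proj₁ (edge e) ≢ proj₂ (edge e)
    simple : ∀ e f →
      (edge e ≡ edge f ⊎ edge e ≡ (proj₂ (edge f) , proj₁ (edge f))) → e ≡ f
open Graph public

module _ {n : ℕ} (G : Graph n) where

  Incident : Fin (m G) → Fin n → Set
  Incident e v = proj₁ (edge G e) ≡ v ⊎ proj₂ (edge G e) ≡ v

  Adj : Fin n → Fin n → Set
  Adj u v = ∃ λ e → edge G e ≡ (u , v) ⊎ edge G e ≡ (v , u)

  data Reachable : Fin n → Fin n → Set where
    here : ∀ {u} → Reachable u u
    step : ∀ {u v w} → Adj u v → Reachable v w → Reachable u w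

  Connected : Set
  Connected = ∀ u v → Reachable u v

  IsMatching : Subset (m G) → Set
  IsMatching H = ∀ e f → e ∈ H → f ∈ H → e ≢ f → ∀ v → Incident e v → Incident f v → Data.Empty.⊥
    where import Data.Empty

  Disjoint : Subset (m G) → Subset (m G) → Set
  Disjoint H H' = ∀ e → e ∈ H → e ∉ H'

  DisjointMatchings : Subset (m G) → Subset (m G) → Set
  DisjointMatchings H H' = IsMatching H × IsMatching H' × Disjoint H H'

  IsNu : ℕ → Set
  IsNu k = (Σ (Subset (m G)) λ H → IsMatching H × ∣ H ∣ ≡ k)
         × (∀ H → IsMatching H → ∣ H ∣ ≤ k)

  IsLambda : ℕ → Set
  IsLambda l = (Σ (Subset (m G)) λ H → Σ (Subset (m G)) λ H' →
                  DisjointMatchings H H' × ∣ H ∣ + ∣ H' ∣ ≡ l)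
             × (∀ H H' → DisjointMatchings H H' → ∣ H ∣ + ∣ H' ∣ ≤ l)

  InΛ : Subset (m G) → Subset (m G) → Set
  InΛ H H' = DisjointMatchings H H' × IsLambda (∣ H ∣ + ∣ H' ∣)

  IsMu : ℕ → Set
  IsMu k = (Σ (Subset (m G)) λ H → Σ (Subset (m G)) λ H' → InΛ H H' × ∣ H ∣ ≡ k)
         × (∀ H H' → InΛ H H' → ∣ H ∣ ≤ k)

module Submission where

-- Write N = ⌊n/2⌋.  A matching covers twice as many vertices as
-- it has edges, so every matching has at most N edges and every pair of
-- disjoint matchings has at most N + N ≤ n edges.  Call a pair (A , B) of
-- disjoint matchings maximum if no pair has more edges in total; then
-- |A| + |B| = λ(G) and (A , B) ∈ Λ(G).  From the given pair (H₀ , H₀') with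
-- |H₀| + |H₀'| ≥ n - 1 we obtain a maximum pair of total size ≥ n - 1: either
-- some pair of disjoint matchings has ≥ n edges (a finite, decidable search),
-- and it is maximum because n bounds every pair, or every pair has ≤ n - 1
-- edges and (H₀ , H₀') itself is maximum.  Listing the larger matching first,
-- it has at least ⌈(n-1)/2⌉ = N edges, hence exactly N; so N is attained both
-- as μ(G) and as ν(G), and it is an upper bound for both.

open import Defs
open import Data.Nat using (ℕ; _≤_; _+_; _∸_; _/_)
open import Data.Fin.Subset using (Subset; ∣_∣)
open import Data.Product using (Σ; _×_)

open import Data.Nat using (suc; _*_; _<_; _≤?_; z≤n; s≤s)
open import Data.Nat.Properties
open import Data.Nat.DivMod using (m*n/n≡m; m/n*n≤m; /-monoˡ-≤)
open import Data.Fin using (Fin) renaming (zero to fzero; suc to fsuc)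
open import Data.Fin.Properties using (all?) renaming (_≟_ to _≟ᶠ_; suc-injective to fsuc-injective)
open import Data.Fin.Subset using (_∈_; _-_; ⊤; inside; outside)
open import Data.Fin.Subset.Properties using (∈⊤; x∈p∧x≢y⇒x∈p-y; x∈p⇒∣p-x∣<∣p∣; _∈?_; anySubset?; ∣⊤∣≡n)
open import Data.Vec using (_∷_; []; here; there)
open import Data.Product using (_,_; proj₁; proj₂)
open import Data.Sum using (_⊎_; inj₁; inj₂)
open import Data.Empty using (⊥)
open import Function using (_∘_)
open import Relation.Nullary using (Dec; yes; no; ¬_; contradiction)
open import Relation.Nullary.Decidable using (¬?; _×-dec_; _⊎-dec_; _→-dec_)
open import Relation.Binary.PropositionalEquality using (_≡_; _≢_; refl; sym; cong; subst; subst₂)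

module _ {n m : ℕ} where

  -- For
  -- edge = edge G these are definitionally Incident G and IsMatching G; the
  -- generality is needed because the counting argument recurses on the list.
  Endpoint : (Fin m → Fin n × Fin n) → Fin m → Fin n → Set
  Endpoint edge e v = proj₁ (edge e) ≡ v ⊎ proj₂ (edge e) ≡ v

  MatchingOn : (Fin m → Fin n × Fin n) → Subset m → Set
  MatchingOn edge H = ∀ e f → e ∈ H → f ∈ H → e ≢ f →
    ∀ v → Endpoint edge e v → Endpoint edge f v → ⊥

  CoveredBy : (Fin m → Fin n × Fin n) → Subset m → Subset n → Set
  CoveredBy edge H S = ∀ e → e ∈ H → ∀ v → Endpoint edge e v → v ∈ S

matching-tail : ∀ {n m} {edge : Fin (suc m) → Fin n × Fin n} {x H} →
  MatchingOn edge (x ∷ H) → MatchingOn (edge ∘ fsuc) H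
matching-tail match e f e∈H f∈H e≢f =
  match (fsuc e) (fsuc f) (there e∈H) (there f∈H) (e≢f ∘ fsuc-injective)

-- Induction on the edge list: a chosen edge ab removes a and b from S, and the
-- remaining edges of H avoid a and b.
matching-covers-twice : ∀ {n m} (edge : Fin m → Fin n × Fin n) (H : Subset m) (S : Subset n) →
  (∀ e → proj₁ (edge e) ≢ proj₂ (edge e)) →
  MatchingOn edge H → CoveredBy edge H S → 2 * ∣ H ∣ ≤ ∣ S ∣
matching-covers-twice edge [] S loopless match covered = z≤n
matching-covers-twice edge (outside ∷ H) S loopless match covered =
  matching-covers-twice (edge ∘ fsuc) H S (loopless ∘ fsuc)
    (matching-tail match) (λ e e∈H → covered (fsuc e) (there e∈H))
matching-covers-twice edge (inside ∷ H) S loopless match covered =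
  subst (_≤ ∣ S ∣) (sym (*-suc 2 ∣ H ∣)) (≤-trans (+-monoʳ-≤ 2 ih) removed-two)
  where
  a = proj₁ (edge fzero)
  b = proj₂ (edge fzero)

  avoids : ∀ e → e ∈ H → ∀ v → Endpoint edge (fsuc e) v → Endpoint edge fzero v → ⊥
  avoids e e∈H = match (fsuc e) fzero (there e∈H) here (λ ())

  tail-covered : CoveredBy (edge ∘ fsuc) H ((S - a) - b)
  tail-covered e e∈H v v∈e =
    x∈p∧x≢y⇒x∈p-y
      (x∈p∧x≢y⇒x∈p-y (covered (fsuc e) (there e∈H) v v∈e)
        (λ v≡a → avoids e e∈H v v∈e (inj₁ (sym v≡a))))
      (λ v≡b → avoids e e∈H v v∈e (inj₂ (sym v≡b)))

  ih : 2 * ∣ H ∣ ≤ ∣ (S - a) - b ∣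
  ih = matching-covers-twice (edge ∘ fsuc) H ((S - a) - b) (loopless ∘ fsuc)
         (matching-tail match) tail-covered

  removed-two : 2 + ∣ (S - a) - b ∣ ≤ ∣ S ∣
  removed-two = ≤-trans
    (s≤s (x∈p⇒∣p-x∣<∣p∣ (x∈p∧x≢y⇒x∈p-y (covered fzero here b (inj₂ refl)) (loopless fzero ∘ sym))))
    (x∈p⇒∣p-x∣<∣p∣ (covered fzero here a (inj₁ refl)))

half+half≤ : ∀ n → n / 2 + n / 2 ≤ n
half+half≤ n = subst (_≤ n) twice≡ (m/n*n≤m n 2)
  where
  twice≡ : n / 2 * 2 ≡ n / 2 + n / 2
  twice≡ = subst (λ k → n / 2 * 2 ≡ n / 2 + k) (+-identityʳ (n / 2)) (*-comm (n / 2) 2)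

-- If b + b ≥ n - 1 then b ≥ ⌊n/2⌋: otherwise (b+1) + (b+1) ≤ n, i.e. b + b < n - 1.
half≤ : ∀ n b → n ∸ 1 ≤ b + b → n / 2 ≤ b
half≤ n b n∸1≤b+b = ≮⇒≥ b<half-impossible
  where
  b<half-impossible : ¬ (b < n / 2)
  b<half-impossible b<half = <⇒≱ b+b<n∸1 n∸1≤b+b
    where
    2+b+b≤n : suc (suc (b + b)) ≤ n
    2+b+b≤n = subst (_≤ n) (cong suc (+-suc b b))
                (≤-trans (+-mono-≤ b<half b<half) (half+half≤ n))
    b+b<n∸1 : b + b < n ∸ 1
    b+b<n∸1 = ∸-monoˡ-≤ 1 2+b+b≤n

module _ {n : ℕ} (G : Graph n) where

  matching≤half : ∀ H → IsMatching G H → ∣ H ∣ ≤ n / 2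
  matching≤half H match = subst (_≤ n / 2) (m*n/n≡m ∣ H ∣ 2) (/-monoˡ-≤ 2 H*2≤n)
    where
    H*2≤n : ∣ H ∣ * 2 ≤ n
    H*2≤n = subst₂ _≤_ (*-comm 2 ∣ H ∣) (∣⊤∣≡n n)
      (matching-covers-twice (edge G) H ⊤ (loopless G) match (λ _ _ _ _ → ∈⊤))

  pair≤n : ∀ H H' → DisjointMatchings G H H' → ∣ H ∣ + ∣ H' ∣ ≤ n
  pair≤n H H' (match , match' , _) =
    ≤-trans (+-mono-≤ (matching≤half H match) (matching≤half H' match')) (half+half≤ n)

  -- Being a pair of disjoint matchings is decidable (all quantifiers range
  -- over finite sets), which makes the search in large-maximum-pair possible.
  disjointMatchings? : ∀ H H' → Dec (DisjointMatchings G H H')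
  disjointMatchings? H H' = matching? H ×-dec matching? H' ×-dec disjoint?
    where
    incident? : ∀ e v → Dec (Incident G e v)
    incident? e v = (proj₁ (edge G e) ≟ᶠ v) ⊎-dec (proj₂ (edge G e) ≟ᶠ v)
    matching? : ∀ K → Dec (IsMatching G K)
    matching? K = all? λ e → all? λ f →
      (e ∈? K) →-dec (f ∈? K) →-dec ¬? (e ≟ᶠ f) →-dec
      all? λ v → incident? e v →-dec incident? f v →-dec no (λ ())
    disjoint? : Dec (Disjoint G H H')
    disjoint? = all? λ e → (e ∈? H) →-dec ¬? (e ∈? H')

  MaximumPair : Subset (m G) → Subset (m G) → Set
  MaximumPair A B = DisjointMatchings G A B ×
    (∀ H H' → DisjointMatchings G H H' → ∣ H ∣ + ∣ H' ∣ ≤ ∣ A ∣ + ∣ B ∣)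

  maximum-pair-in-Λ : ∀ A B → MaximumPair A B → InΛ G A B
  maximum-pair-in-Λ A B (dm , maximal) = dm , (A , B , dm , refl) , maximal

  -- Given a pair with ≥ n - 1 edges, some maximum pair also has ≥ n - 1 edges:
  -- a pair with ≥ n edges is maximum by pair≤n; if there is none, every pair
  -- has ≤ n - 1 edges and the given pair is maximum.
  large-maximum-pair : ∀ H₀ H₀' → DisjointMatchings G H₀ H₀' → n ∸ 1 ≤ ∣ H₀ ∣ + ∣ H₀' ∣ →
    Σ (Subset (m G)) λ A → Σ (Subset (m G)) λ B → MaximumPair A B × n ∸ 1 ≤ ∣ A ∣ + ∣ B ∣
  large-maximum-pair H₀ H₀' dm₀ large₀
    with anySubset? (λ H → anySubset? (λ H' → disjointMatchings? H H' ×-dec (n ≤? ∣ H ∣ + ∣ H' ∣)))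
  ... | yes (A , B , dm , n≤) =
        A , B , (dm , λ H H' dm' → ≤-trans (pair≤n H H' dm') n≤) , ≤-trans (m∸n≤m n 1) n≤
  ... | no no-pair-of-size-n = H₀ , H₀' , (dm₀ , below-n) , large₀
    where
    below-n : ∀ H H' → DisjointMatchings G H H' → ∣ H ∣ + ∣ H' ∣ ≤ ∣ H₀ ∣ + ∣ H₀' ∣
    below-n H H' dm with n ≤? ∣ H ∣ + ∣ H' ∣
    ... | yes n≤ = contradiction (H , H' , dm , n≤) no-pair-of-size-n
    ... | no n≰ = ≤-trans (∸-monoˡ-≤ 1 (≰⇒> n≰)) large₀

  swap-maximum : ∀ A B → MaximumPair A B → MaximumPair B A
  swap-maximum A B ((match , match' , disjoint) , maximal) =
    (match' , match , λ e e∈B e∈A → disjoint e e∈A e∈B) ,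
    λ H H' dm → subst (∣ H ∣ + ∣ H' ∣ ≤_) (+-comm ∣ A ∣ ∣ B ∣) (maximal H H' dm)

  maximum-pair-with-half : ∀ A B → MaximumPair A B → n ∸ 1 ≤ ∣ A ∣ + ∣ B ∣ →
    Σ (Subset (m G)) λ A' → Σ (Subset (m G)) λ B' → MaximumPair A' B' × n / 2 ≤ ∣ A' ∣
  maximum-pair-with-half A B max large with ∣ B ∣ ≤? ∣ A ∣
  ... | yes B≤A = A , B , max , half≤ n ∣ A ∣ (≤-trans large (+-monoʳ-≤ ∣ A ∣ B≤A))
  ... | no B≰A = B , A , swap-maximum A B max ,
        half≤ n ∣ B ∣ (≤-trans large (+-monoˡ-≤ ∣ B ∣ (<⇒≤ (≰⇒> B≰A))))

  mu-nu-from-maximum-pair : ∀ A B → MaximumPair A B → n / 2 ≤ ∣ A ∣ →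
    IsMu G (n / 2) × IsNu G (n / 2)
  mu-nu-from-maximum-pair A B max@((match , _) , _) half≤A =
    ((A , B , maximum-pair-in-Λ A B max , A≡half) ,
      λ H H' ((match-H , _) , _) → matching≤half H match-H)
    , ((A , match , A≡half) , matching≤half)
    where
    A≡half : ∣ A ∣ ≡ n / 2
    A≡half = ≤-antisym (matching≤half A match) half≤A

lemma4p2 : (n : ℕ) (G : Graph n) → Connected G →
    (Σ (Subset (m G)) λ H → Σ (Subset (m G)) λ H' →
    DisjointMatchings G H H' × n ∸ 1 ≤ ∣ H ∣ + ∣ H' ∣) →
    IsMu G (n / 2) × IsNu G (n / 2)
lemma4p2 n G _ (H₀ , H₀' , dm₀ , large₀) =
  let (A , B , max , large) = large-maximum-pair G H₀ H₀' dm₀ large₀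
      (A' , B' , max' , half≤A') = maximum-pair-with-half G A B max large
  in  mu-nu-from-maximum-pair G A' B' max' half≤A'
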